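{- Let $a=\alpha^s$ and $b=\alpha^u$ with $s,u\in D\setminus\{x_0\}$. Let $P$ be the plane $bx+b^qy+b^{q^2}z+b^{q^3}t=0$ in $PG(3,q^4)$ and let $\Psi$ be the hypersurface $(a\sqrt{x}+a^q\sqrt{y}+a^{q^2}\sqrt{z}+a^{q^3}\sqrt{t})(a\sqrt{x}-a^q\sqrt{y}+a^{q^2}\sqrt{z}-a^{q^3}\sqrt{t})=0$, with membership of points of $O^{(e)}$ interpreted as in the context. If $a^2b^{q^2}=a^{2q^2}b$, then $|O^{(e)}\cap P\cap\Psi|\le 2$.
   Context: $q$ is an odd prime power, $\alpha$ a primitive element of $\mathbb{F}_{q^4}$, $\mathrm{Tr}(a)=a+a^q+a^{q^2}+a^{q^3}$. Let $n=(q^2+1)(q+1)$, $D=\{i\in\mathbb{Z}_n:\mathrm{Tr}(\alpha^i)=0\}$, $x_0=(q^2+1)(q+1)/2$. For an integer $l$ let $\omega(l)=(\alpha^l:\alpha^{lq}:\alpha^{lq^2}:\alpha^{lq^3})\in PG(3,q^4)$, and $O^{(e)}=\{\omega(2i(q+1)):0\le i<(q^2+1)/2\}$ (the even-indexed points of the image of the ovoid $\{L(\alpha^{(q+1)i})\}$ of $PG(3,q)$; these points satisfy $xz-yt=0$). For $0\le i<(q^2+1)/2$ the point $\omega(2i(q+1))$ lies on $\Psi$ iff the defining product vanishes when $(\sqrt{x},\sqrt{y},\sqrt{z},\sqrt{t})$ is taken to be $(\alpha^{i(q+1)},\alpha^{iq(q+1)},\alpha^{iq^2(q+1)},\alpha^{iq^3(q+1)})$;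 i.e. iff $w+w^q+w^{q^2}+w^{q^3}=0$ or $w-w^q+w^{q^2}-w^{q^3}=0$ where $w=\alpha^{s+i(q+1)}$. -}

module Defs where

open import Level using (Level)
open import Data.Nat as ℕ using (ℕ; zero; suc; _<_; _≤_)
open import Data.Nat.Primality using (Prime)
open import Data.Nat.DivMod using (_/_)
open import Data.Product using (Σ; ∃; _×_; _,_)
open import Data.Sum using (_⊎_)
open import Data.List using (List; length)
open import Data.List.Relation.Unary.All using (All)
open import Data.List.Relation.Unary.Unique.Propositional using (Unique)
open import Relation.Nullary using (¬_)
open import Relation.Binary.PropositionalEquality using (_≡_)
open import Algebra.Bundles using (CommutativeRing)

OddPrimePower : ℕ → Set
OddPrimePower q = Σ ℕ λ p → Σ ℕ λ k → Prime p × ¬ (p ≡ 2) × 1 ≤ k × q ≡ p ℕ.^ k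

module FieldDefs {c ℓ : Level} (F : CommutativeRing c ℓ) where
  open CommutativeRing F

  infixr 8 _^_
  _^_ : Carrier → ℕ → Carrier
  x ^ zero  = 1#
  x ^ suc n = x * (x ^ n)

  record IsField : Set (c Level.⊔ ℓ) where
    field
      0≉1     : ¬ (0# ≈ 1#)
      inverse : ∀ x → ¬ (x ≈ 0#) → ∃ λ y → x * y ≈ 1#

  -- α is a primitive element of a field with exactly N elements
  -- (N = q^4): α has multiplicative order N - 1 and every element is
  -- 0 or a power of α.
  record IsPrimitiveOfOrder (N : ℕ) (α : Carrier) : Set (c Level.⊔ ℓ) where
    field
      order-eq  : α ^ (N ℕ.∸ 1) ≈ 1#
      order-min : ∀ k → 0 < k → k < N ℕ.∸ 1 → ¬ (α ^ k ≈ 1#)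
      covers    : ∀ x → x ≈ 0# ⊎ (∃ λ j → j < N ℕ.∸ 1 × x ≈ α ^ j)

  module _ (q : ℕ) where
    Tr : Carrier → Carrier
    Tr x = x + x ^ q + x ^ (q ℕ.^ 2) + x ^ (q ℕ.^ 3)

    Alt : Carrier → Carrier
    Alt x = x - x ^ q + x ^ (q ℕ.^ 2) - x ^ (q ℕ.^ 3)

    n : ℕ
    n = (q ℕ.^ 2 ℕ.+ 1) ℕ.* (q ℕ.+ 1)

    x₀ : ℕ
    x₀ = n / 2

    module _ (α : Carrier) where
      -- i ∈ D, with i ∈ Z_n represented by 0 ≤ i < n
      InD : ℕ → Set ℓ
      InD i = i < n × Tr (α ^ i) ≈ 0#

      -- ω(l) lies on the plane b x + b^q y + b^{q^2} z + b^{q^3} t = 0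
      OnPlane : Carrier → ℕ → Set ℓ
      OnPlane b l = b * α ^ l + b ^ q * α ^ (l ℕ.* q)
                    + b ^ (q ℕ.^ 2) * α ^ (l ℕ.* q ℕ.^ 2)
                    + b ^ (q ℕ.^ 3) * α ^ (l ℕ.* q ℕ.^ 3) ≈ 0#

      -- ω(2i(q+1)) lies on Ψ (for a = α^s), as interpreted in the context:
      -- w = α^{s + i(q+1)} satisfies Tr w = 0 or Alt w = 0
      OnΨ : ℕ → ℕ → Set ℓ
      OnΨ s i = Tr (α ^ (s ℕ.+ i ℕ.* (q ℕ.+ 1))) ≈ 0#
                ⊎ Alt (α ^ (s ℕ.+ i ℕ.* (q ℕ.+ 1))) ≈ 0#

      -- the point ω(2i(q+1)) of O^(e) (index 0 ≤ i < (q^2+1)/2) lies in P ∩ Ψ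
      InOePΨ : ℕ → Carrier → ℕ → Set ℓ
      InOePΨ s b i = i < (q ℕ.^ 2 ℕ.+ 1) / 2
                     × OnPlane b (2 ℕ.* i ℕ.* (q ℕ.+ 1))
                     × OnΨ s i

{-# OPTIONS --safe #-}
-- Write A_k = a^(q^k), B_k = b^(q^k) and, for the point of index i, v = α^(i(q+1)) and V_k = v^(q^k).
-- The hypothesis a²B₂ = A₂²b and its Frobenius image A₁²B₃ = A₃²B₁, the plane equation
-- b v² + Σ B_k V_k² = 0, the equation (av + A₂V₂)² = (A₁V₁ + A₃V₃)² expressing Ψ, and vV₂ = V₁V₃
-- combine to say that (v : V₂) is a zero of the binary quadratic form d a² X² + k XZ + d A₂² Z²,
-- where d = A₁²b + a²B₁ and k = 2a²B₁(aA₂ − A₁A₃) do not depend on the point. Distinct indices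
-- below (q² + 1)/2 give non-proportional zeros, so three points force d = 0 and then k = 0, that
-- is aA₂ = A₁A₃. Together with Tr a = 0 this factors as (a + A₁)(a + A₃) = 0, whence a^q = −a,
-- and as −1 = α^(n(q−1)/2) this pins s down to x₀ = n/2.
module Submission where

open import Level using (Level)
open import Algebra.Bundles using (CommutativeRing)
open import Data.Nat using (ℕ; zero; suc; NonZero; z≤n; s≤s; z<s)
import Data.Nat as ℕ
import Data.Nat.Properties as ℕₚ
open import Data.Nat.Divisibility
  using (_∣_; _∤_; ∣⇒≤; ∣1⇒≡1; ∣m+n∣m⇒∣n; ∣n⇒∣m*n; *-cancelˡ-∣; m%n≡0⇒n∣m; n∣m⇒m%n≡0)
open import Data.Nat.DivMod using (_/_; _%_; m≡m%n+[m/n]*n; m%n<n; m*n/n≡m; m<n⇒m%n≡m)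
open import Data.Nat.Coprimality using (Coprime; coprime-divisor)
open import Data.Nat.Primality using (Prime; ¬prime[1]; prime[2]; prime⇒irreducible; euclidsLemma)
open import Data.Integer as ℤ using (ℤ; +_; -[1+_]; _◃_; _⊖_; sign; ∣_∣)
open import Data.Integer.Properties using ([1+m]⊖[1+n]≡m⊖n; ◃-inverse)
open import Data.Sign as Sign using (Sign)
open import Data.Maybe using (Maybe; just; nothing)
open import Data.List using (List; []; _∷_; length)
open import Data.List.Relation.Unary.All using (All; []; _∷_)
open import Data.List.Relation.Unary.Unique.Propositional using (Unique)
open import Data.List.Relation.Unary.AllPairs using ([]; _∷_)
open import Data.Product using (∃-syntax; _×_; _,_)
open import Data.Sum using (_⊎_; inj₁; inj₂; [_,_]′)
import Data.Sum as Sum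
open import Data.Empty using (⊥; ⊥-elim)
open import Function using (id; _∘_)
open import Relation.Nullary using (¬_; Dec; yes; no)
open import Relation.Binary using (tri<; tri≈; tri>)
open import Relation.Binary.PropositionalEquality as ≡ using (_≡_; _≢_)
import Algebra.Solver.Ring.AlmostCommutativeRing as ACR
open import Defs

-- Algebra.Solver.Ring needs a coefficient ring with a decidable equality mapping into the
-- target; ℤ, via its canonical morphism, serves every commutative ring.
module IntegerCoefficientSolver {c ℓ : Level} (R : CommutativeRing c ℓ) where
  open CommutativeRing R
  open import Algebra.Properties.Ring ring using (-0#≈0#; -‿involutive; -‿distribˡ-*; -‿distribʳ-*; -‿+-comm)
  open import Algebra.Properties.Monoid.Mult +-monoid using (×-homo-+) renaming (_×_ to _·_)
  open import Algebra.Properties.Semiring.Mult semiring using (×1-homo-*)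
  open import Algebra.Properties.CommutativeSemigroup +-commutativeSemigroup using (interchange)
  open import Relation.Binary.Reasoning.Setoid setoid

  fromℕ : ℕ → Carrier
  fromℕ n = n · 1#

  fromℤ : ℤ → Carrier
  fromℤ (+ n)      = fromℕ n
  fromℤ -[1+ n ]   = - fromℕ (suc n)

  signed : Sign → Carrier → Carrier
  signed Sign.+ x = x
  signed Sign.- x = - x

  signed-cong : ∀ σ {x y} → x ≈ y → signed σ x ≈ signed σ y
  signed-cong Sign.+ = id
  signed-cong Sign.- = -‿cong

  signed-* : ∀ σ τ x y → signed (σ Sign.* τ) (x * y) ≈ signed σ x * signed τ y
  signed-* Sign.+ Sign.+ x y = refl
  signed-* Sign.+ Sign.- x y = -‿distribʳ-* x y
  signed-* Sign.- Sign.+ x y = -‿distribˡ-* x y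
  signed-* Sign.- Sign.- x y = begin
    x * y         ≈⟨ -‿involutive (x * y) ⟨
    - - (x * y)   ≈⟨ -‿cong (-‿distribˡ-* x y) ⟩
    - (- x * y)   ≈⟨ -‿distribʳ-* (- x) y ⟩
    - x * - y     ∎

  fromℤ-◃ : ∀ σ n → fromℤ (σ ◃ n) ≈ signed σ (fromℕ n)
  fromℤ-◃ Sign.+ zero    = refl
  fromℤ-◃ Sign.- zero    = sym -0#≈0#
  fromℤ-◃ Sign.+ (suc n) = refl
  fromℤ-◃ Sign.- (suc n) = refl

  fromℤ-signAbs : ∀ i → fromℤ i ≈ signed (sign i) (fromℕ ∣ i ∣)
  fromℤ-signAbs i = trans (reflexive (≡.cong fromℤ (≡.sym (◃-inverse i)))) (fromℤ-◃ (sign i) ∣ i ∣)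

  fromℤ-⊖ : ∀ m n → fromℤ (m ⊖ n) ≈ fromℕ m - fromℕ n
  fromℤ-⊖ m       zero    = sym (trans (+-congˡ -0#≈0#) (+-identityʳ (fromℕ m)))
  fromℤ-⊖ zero    (suc n) = sym (+-identityˡ _)
  fromℤ-⊖ (suc m) (suc n) = begin
    fromℤ (suc m ⊖ suc n)                  ≡⟨ ≡.cong fromℤ ([1+m]⊖[1+n]≡m⊖n m n) ⟩
    fromℤ (m ⊖ n)                          ≈⟨ fromℤ-⊖ m n ⟩
    fromℕ m - fromℕ n                      ≈⟨ +-identityˡ _ ⟨
    0# + (fromℕ m - fromℕ n)               ≈⟨ +-congʳ (-‿inverseʳ 1#) ⟨
    (1# - 1#) + (fromℕ m - fromℕ n)        ≈⟨ interchange 1# (- 1#) (fromℕ m) (- fromℕ n) ⟩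
    (1# + fromℕ m) + (- 1# - fromℕ n)      ≈⟨ +-congˡ (-‿+-comm 1# (fromℕ n)) ⟩
    fromℕ (suc m) - fromℕ (suc n)          ∎

  fromℤ-+ : ∀ i j → fromℤ (i ℤ.+ j) ≈ fromℤ i + fromℤ j
  fromℤ-+ (+ m)    (+ n)    = ×-homo-+ 1# m n
  fromℤ-+ (+ m)    -[1+ n ] = fromℤ-⊖ m (suc n)
  fromℤ-+ -[1+ m ] (+ n)    = trans (fromℤ-⊖ n (suc m)) (+-comm _ _)
  fromℤ-+ -[1+ m ] -[1+ n ] = begin
    - fromℕ (suc (suc (m ℕ.+ n)))          ≡⟨ ≡.cong (λ k → - fromℕ (suc k)) (≡.sym (ℕₚ.+-suc m n)) ⟩
    - fromℕ (suc m ℕ.+ suc n)              ≈⟨ -‿cong (×-homo-+ 1# (suc m) (suc n)) ⟩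
    - (fromℕ (suc m) + fromℕ (suc n))      ≈⟨ -‿+-comm _ _ ⟨
    - fromℕ (suc m) + - fromℕ (suc n)      ∎

  fromℤ-neg : ∀ i → fromℤ (ℤ.- i) ≈ - fromℤ i
  fromℤ-neg (+ zero)  = sym -0#≈0#
  fromℤ-neg (+ suc n) = refl
  fromℤ-neg -[1+ n ]  = sym (-‿involutive _)

  fromℤ-* : ∀ i j → fromℤ (i ℤ.* j) ≈ fromℤ i * fromℤ j
  fromℤ-* i j = begin
    fromℤ (σ ◃ ∣ i ∣ ℕ.* ∣ j ∣)                                     ≈⟨ fromℤ-◃ σ (∣ i ∣ ℕ.* ∣ j ∣) ⟩
    signed σ (fromℕ (∣ i ∣ ℕ.* ∣ j ∣))                               ≈⟨ signed-cong σ (×1-homo-* ∣ i ∣ ∣ j ∣) ⟩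
    signed σ (fromℕ ∣ i ∣ * fromℕ ∣ j ∣)                             ≈⟨ signed-* (sign i) (sign j) _ _ ⟩
    signed (sign i) (fromℕ ∣ i ∣) * signed (sign j) (fromℕ ∣ j ∣)   ≈⟨ *-cong (fromℤ-signAbs i) (fromℤ-signAbs j) ⟨
    fromℤ i * fromℤ j                                                ∎
    where
    σ : Sign
    σ = sign i Sign.* sign j

  fromℤ-homomorphism : ℤ.+-*-rawRing ACR.-Raw-AlmostCommutative⟶ ACR.fromCommutativeRing R
  fromℤ-homomorphism = record
    { ⟦_⟧    = fromℤ
    ; +-homo = fromℤ-+
    ; *-homo = fromℤ-*
    ; -‿homo = fromℤ-neg
    ; 0-homo = refl
    ; 1-homo = +-identityʳ 1#
    }

  fromℤ-≟ : ∀ i j → Maybe (fromℤ i ≈ fromℤ j)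
  fromℤ-≟ i j with i ℤ.≟ j
  ... | yes ≡.refl = just refl
  ... | no _       = nothing

  open import Algebra.Solver.Ring ℤ.+-*-rawRing (ACR.fromCommutativeRing R) fromℤ-homomorphism fromℤ-≟ public

module RingLemmas {c ℓ : Level} (R : CommutativeRing c ℓ) where
  open CommutativeRing R
  open FieldDefs R using (_^_)
  open import Algebra.Properties.Ring ring using (-‿distribˡ-*; x≈y⇒x∙y⁻¹≈ε; x∙y⁻¹≈ε⇒x≈y)
  import Algebra.Properties.CommutativeSemiring.Exp commutativeSemiring as Exp
  open IntegerCoefficientSolver R using (solve; _:+_; _:-_; _:*_; :-_; _:=_)
  open import Relation.Binary.Reasoning.Setoid setoid

  ^≡Exp^ : ∀ x n → x ^ n ≡ x Exp.^ n
  ^≡Exp^ x zero    = ≡.refl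
  ^≡Exp^ x (suc n) = ≡.cong (x *_) (^≡Exp^ x n)

  ^-congˡ : ∀ n {x y} → x ≈ y → x ^ n ≈ y ^ n
  ^-congˡ n {x} {y} rewrite ^≡Exp^ x n | ^≡Exp^ y n = Exp.^-congˡ n

  ^-homo-* : ∀ x m n → x ^ (m ℕ.+ n) ≈ x ^ m * x ^ n
  ^-homo-* x m n rewrite ^≡Exp^ x (m ℕ.+ n) | ^≡Exp^ x m | ^≡Exp^ x n = Exp.^-homo-* x m n

  ^-assocʳ : ∀ x m n → (x ^ m) ^ n ≈ x ^ (m ℕ.* n)
  ^-assocʳ x m n rewrite ^≡Exp^ (x ^ m) n | ^≡Exp^ x m | ^≡Exp^ x (m ℕ.* n) = Exp.^-assocʳ x m n

  ^-distrib-* : ∀ x y n → (x * y) ^ n ≈ x ^ n * y ^ n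
  ^-distrib-* x y n rewrite ^≡Exp^ (x * y) n | ^≡Exp^ x n | ^≡Exp^ y n = Exp.^-distrib-* x y n

  [x^[p^k]]^p≈x^[p^[1+k]] : ∀ x p k → (x ^ (p ℕ.^ k)) ^ p ≈ x ^ (p ℕ.^ suc k)
  [x^[p^k]]^p≈x^[p^[1+k]] x p k = trans (^-assocʳ x (p ℕ.^ k) p) (reflexive (≡.cong (x ^_) (ℕₚ.*-comm (p ℕ.^ k) p)))

  -x^[1+2t]≈-[x^[1+2t]] : ∀ x t → (- x) ^ suc (2 ℕ.* t) ≈ - (x ^ suc (2 ℕ.* t))
  -x^[1+2t]≈-[x^[1+2t]] x t = begin
    - x * (- x) ^ (2 ℕ.* t)     ≈⟨ *-congˡ (^-assocʳ (- x) 2 t) ⟨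
    - x * ((- x) ^ 2) ^ t       ≈⟨ *-congˡ (^-congˡ t (solve 2 (λ x o → (:- x) :* ((:- x) :* o) := x :* (x :* o)) refl x 1#)) ⟩
    - x * (x ^ 2) ^ t           ≈⟨ *-congˡ (^-assocʳ x 2 t) ⟩
    - x * x ^ (2 ℕ.* t)         ≈⟨ -‿distribˡ-* x _ ⟨
    - (x * x ^ (2 ℕ.* t))       ∎

  [p₀+p₂]²≈[p₁+p₃]² : ∀ p₀ p₁ p₂ p₃ → p₀ + p₁ + p₂ + p₃ ≈ 0# ⊎ p₀ - p₁ + p₂ - p₃ ≈ 0# →
                      (p₀ + p₂) * (p₀ + p₂) ≈ (p₁ + p₃) * (p₁ + p₃)
  [p₀+p₂]²≈[p₁+p₃]² p₀ p₁ p₂ p₃ tr⊎alt≈0 = x∙y⁻¹≈ε⇒x≈y _ _ (begin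
    (p₀ + p₂) * (p₀ + p₂) - (p₁ + p₃) * (p₁ + p₃)  ≈⟨ solve 4 (λ p₀ p₁ p₂ p₃ →
      (p₀ :+ p₂) :* (p₀ :+ p₂) :- (p₁ :+ p₃) :* (p₁ :+ p₃) := (p₀ :- p₁ :+ p₂ :- p₃) :* (p₀ :+ p₁ :+ p₂ :+ p₃))
      refl p₀ p₁ p₂ p₃ ⟩
    (p₀ - p₁ + p₂ - p₃) * (p₀ + p₁ + p₂ + p₃)      ≈⟨ [ (λ tr≈0 → trans (*-congˡ tr≈0) (zeroʳ _))
                                                      , (λ alt≈0 → trans (*-congʳ alt≈0) (zeroˡ _)) ]′ tr⊎alt≈0 ⟩
    0#                                             ∎)

  [x₀+x₁][x₀+x₃]≈0 : ∀ x₀ x₁ x₂ x₃ → x₀ + x₁ + x₂ + x₃ ≈ 0# → x₀ * x₂ ≈ x₁ * x₃ →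
                     (x₀ + x₁) * (x₀ + x₃) ≈ 0#
  [x₀+x₁][x₀+x₃]≈0 x₀ x₁ x₂ x₃ tr≈0 x₀x₂≈x₁x₃ = begin
    (x₀ + x₁) * (x₀ + x₃)                           ≈⟨ solve 4 (λ x₀ x₁ x₂ x₃ →
      (x₀ :+ x₁) :* (x₀ :+ x₃) := x₀ :* (x₀ :+ x₁ :+ x₂ :+ x₃) :+ (x₁ :* x₃ :- x₀ :* x₂)) refl x₀ x₁ x₂ x₃ ⟩
    x₀ * (x₀ + x₁ + x₂ + x₃) + (x₁ * x₃ - x₀ * x₂)
                                                     ≈⟨ +-cong (*-congˡ tr≈0) (x≈y⇒x∙y⁻¹≈ε (sym x₀x₂≈x₁x₃)) ⟩
    x₀ * 0# + 0#                                     ≈⟨ trans (+-identityʳ _) (zeroʳ x₀) ⟩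
    0#                                               ∎

  quadraticForm : Carrier → Carrier → Carrier → Carrier → Carrier → Carrier
  quadraticForm a b c x z = a * (x * x) + b * (x * z) + c * (z * z)

module IntersectionForm {c ℓ : Level} (R : CommutativeRing c ℓ) (A₀ A₁ A₂ A₃ B₀ B₁ B₂ B₃ : CommutativeRing.Carrier R) where
  open CommutativeRing R
  open RingLemmas R using (quadraticForm)
  open import Algebra.Properties.Ring ring using (x≈y⇒x∙y⁻¹≈ε)
  open IntegerCoefficientSolver R using (solve; _:+_; _:-_; _:*_; _:=_)
  open import Relation.Binary.Reasoning.Setoid setoid

  d k : Carrier
  d = A₁ * A₁ * B₀ + A₀ * A₀ * B₁
  k = A₀ * A₀ * B₁ * ((A₀ * A₂ - A₁ * A₃) + (A₀ * A₂ - A₁ * A₃))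

  Q : Carrier → Carrier → Carrier
  Q = quadraticForm (A₀ * A₀ * d) k (A₂ * A₂ * d)

  module _ {V₀ V₁ V₂ V₃ : Carrier} where
    Z₀ Z₁ : Carrier
    Z₀ = A₀ * A₀ * (V₀ * V₀) + A₂ * A₂ * (V₂ * V₂)
    Z₁ = A₁ * A₁ * (V₁ * V₁) + A₃ * A₃ * (V₃ * V₃)

    plane⇒A₁²B₀Z₀+A₀²B₁Z₁≈0 : A₀ * A₀ * B₂ ≈ A₂ * A₂ * B₀ → A₁ * A₁ * B₃ ≈ A₃ * A₃ * B₁ →
                              B₀ * (V₀ * V₀) + B₁ * (V₁ * V₁) + B₂ * (V₂ * V₂) + B₃ * (V₃ * V₃) ≈ 0# →
                              A₁ * A₁ * B₀ * Z₀ + A₀ * A₀ * B₁ * Z₁ ≈ 0#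
    plane⇒A₁²B₀Z₀+A₀²B₁Z₁≈0 A₀²B₂≈A₂²B₀ A₁²B₃≈A₃²B₁ plane = begin
      A₁ * A₁ * B₀ * Z₀ + A₀ * A₀ * B₁ * Z₁
        ≈⟨ solve 12 (λ A₀ A₁ A₂ A₃ B₀ B₁ B₂ B₃ V₀ V₁ V₂ V₃ →
             A₁ :* A₁ :* B₀ :* (A₀ :* A₀ :* (V₀ :* V₀) :+ A₂ :* A₂ :* (V₂ :* V₂))
               :+ A₀ :* A₀ :* B₁ :* (A₁ :* A₁ :* (V₁ :* V₁) :+ A₃ :* A₃ :* (V₃ :* V₃))
             := A₀ :* A₀ :* (A₁ :* A₁) :* (B₀ :* (V₀ :* V₀) :+ B₁ :* (V₁ :* V₁))
               :+ A₁ :* A₁ :* (V₂ :* V₂) :* (A₂ :* A₂ :* B₀) :+ A₀ :* A₀ :* (V₃ :* V₃) :* (A₃ :* A₃ :* B₁))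
             refl A₀ A₁ A₂ A₃ B₀ B₁ B₂ B₃ V₀ V₁ V₂ V₃ ⟩
      A₀ * A₀ * (A₁ * A₁) * (B₀ * (V₀ * V₀) + B₁ * (V₁ * V₁))
        + A₁ * A₁ * (V₂ * V₂) * (A₂ * A₂ * B₀) + A₀ * A₀ * (V₃ * V₃) * (A₃ * A₃ * B₁)
        ≈⟨ +-cong (+-congˡ (*-congˡ A₀²B₂≈A₂²B₀)) (*-congˡ A₁²B₃≈A₃²B₁) ⟨
      A₀ * A₀ * (A₁ * A₁) * (B₀ * (V₀ * V₀) + B₁ * (V₁ * V₁))
        + A₁ * A₁ * (V₂ * V₂) * (A₀ * A₀ * B₂) + A₀ * A₀ * (V₃ * V₃) * (A₁ * A₁ * B₃)
        ≈⟨ solve 12 (λ A₀ A₁ A₂ A₃ B₀ B₁ B₂ B₃ V₀ V₁ V₂ V₃ →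
             A₀ :* A₀ :* (A₁ :* A₁) :* (B₀ :* (V₀ :* V₀) :+ B₁ :* (V₁ :* V₁))
               :+ A₁ :* A₁ :* (V₂ :* V₂) :* (A₀ :* A₀ :* B₂) :+ A₀ :* A₀ :* (V₃ :* V₃) :* (A₁ :* A₁ :* B₃)
             := A₀ :* A₀ :* (A₁ :* A₁) :* (B₀ :* (V₀ :* V₀) :+ B₁ :* (V₁ :* V₁) :+ B₂ :* (V₂ :* V₂) :+ B₃ :* (V₃ :* V₃)))
             refl A₀ A₁ A₂ A₃ B₀ B₁ B₂ B₃ V₀ V₁ V₂ V₃ ⟩
      A₀ * A₀ * (A₁ * A₁) * (B₀ * (V₀ * V₀) + B₁ * (V₁ * V₁) + B₂ * (V₂ * V₂) + B₃ * (V₃ * V₃))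
        ≈⟨ *-congˡ plane ⟩
      A₀ * A₀ * (A₁ * A₁) * 0#
        ≈⟨ zeroʳ _ ⟩
      0# ∎

    Ψ⇒Z₀+2A₀A₂V₀V₂≈Z₁+2A₁A₃V₀V₂ :
      (A₀ * V₀ + A₂ * V₂) * (A₀ * V₀ + A₂ * V₂) ≈ (A₁ * V₁ + A₃ * V₃) * (A₁ * V₁ + A₃ * V₃) → V₀ * V₂ ≈ V₁ * V₃ →
      Z₀ + (A₀ * A₂ * (V₀ * V₂) + A₀ * A₂ * (V₀ * V₂)) ≈ Z₁ + (A₁ * A₃ * (V₀ * V₂) + A₁ * A₃ * (V₀ * V₂))
    Ψ⇒Z₀+2A₀A₂V₀V₂≈Z₁+2A₁A₃V₀V₂ ψ V₀V₂≈V₁V₃ = begin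
      Z₀ + (A₀ * A₂ * (V₀ * V₂) + A₀ * A₂ * (V₀ * V₂))  ≈⟨ square A₀ A₂ V₀ V₂ ⟨
      (A₀ * V₀ + A₂ * V₂) * (A₀ * V₀ + A₂ * V₂)          ≈⟨ ψ ⟩
      (A₁ * V₁ + A₃ * V₃) * (A₁ * V₁ + A₃ * V₃)          ≈⟨ square A₁ A₃ V₁ V₃ ⟩
      Z₁ + (A₁ * A₃ * (V₁ * V₃) + A₁ * A₃ * (V₁ * V₃))  ≈⟨ +-congˡ (+-cong (*-congˡ V₀V₂≈V₁V₃) (*-congˡ V₀V₂≈V₁V₃)) ⟨
      Z₁ + (A₁ * A₃ * (V₀ * V₂) + A₁ * A₃ * (V₀ * V₂))  ∎
      where
      square : ∀ a a′ v v′ → (a * v + a′ * v′) * (a * v + a′ * v′) ≈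
                             a * a * (v * v) + a′ * a′ * (v′ * v′) + (a * a′ * (v * v′) + a * a′ * (v * v′))
      square = solve 4 (λ a a′ v v′ → (a :* v :+ a′ :* v′) :* (a :* v :+ a′ :* v′) :=
                 a :* a :* (v :* v) :+ a′ :* a′ :* (v′ :* v′) :+ (a :* a′ :* (v :* v′) :+ a :* a′ :* (v :* v′))) refl

    -- Q V₀ V₂ is the combination of the two relations above that eliminates Z₁.
    plane∧Ψ⇒Q≈0 : A₀ * A₀ * B₂ ≈ A₂ * A₂ * B₀ → A₁ * A₁ * B₃ ≈ A₃ * A₃ * B₁ →
                  B₀ * (V₀ * V₀) + B₁ * (V₁ * V₁) + B₂ * (V₂ * V₂) + B₃ * (V₃ * V₃) ≈ 0# →
                  (A₀ * V₀ + A₂ * V₂) * (A₀ * V₀ + A₂ * V₂) ≈ (A₁ * V₁ + A₃ * V₃) * (A₁ * V₁ + A₃ * V₃) →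
                  V₀ * V₂ ≈ V₁ * V₃ →
                  Q V₀ V₂ ≈ 0#
    plane∧Ψ⇒Q≈0 A₀²B₂≈A₂²B₀ A₁²B₃≈A₃²B₁ plane ψ V₀V₂≈V₁V₃ = begin
      Q V₀ V₂
        ≈⟨ solve 10 (λ A₀ A₁ A₂ A₃ B₀ B₁ V₀ V₁ V₂ V₃ →
             let d = A₁ :* A₁ :* B₀ :+ A₀ :* A₀ :* B₁
                 Z₀ = A₀ :* A₀ :* (V₀ :* V₀) :+ A₂ :* A₂ :* (V₂ :* V₂)
                 Z₁ = A₁ :* A₁ :* (V₁ :* V₁) :+ A₃ :* A₃ :* (V₃ :* V₃)
                 m = V₀ :* V₂
             in A₀ :* A₀ :* d :* (V₀ :* V₀)
                  :+ A₀ :* A₀ :* B₁ :* ((A₀ :* A₂ :- A₁ :* A₃) :+ (A₀ :* A₂ :- A₁ :* A₃)) :* (V₀ :* V₂)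
                  :+ A₂ :* A₂ :* d :* (V₂ :* V₂)
                := (A₁ :* A₁ :* B₀ :* Z₀ :+ A₀ :* A₀ :* B₁ :* Z₁)
                  :+ A₀ :* A₀ :* B₁ :* ((Z₀ :+ (A₀ :* A₂ :* m :+ A₀ :* A₂ :* m)) :- (Z₁ :+ (A₁ :* A₃ :* m :+ A₁ :* A₃ :* m))))
             refl A₀ A₁ A₂ A₃ B₀ B₁ V₀ V₁ V₂ V₃ ⟩
      (A₁ * A₁ * B₀ * Z₀ + A₀ * A₀ * B₁ * Z₁)
        + A₀ * A₀ * B₁ * ((Z₀ + (A₀ * A₂ * (V₀ * V₂) + A₀ * A₂ * (V₀ * V₂))) - (Z₁ + (A₁ * A₃ * (V₀ * V₂) + A₁ * A₃ * (V₀ * V₂))))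
        ≈⟨ +-cong (plane⇒A₁²B₀Z₀+A₀²B₁Z₁≈0 A₀²B₂≈A₂²B₀ A₁²B₃≈A₃²B₁ plane)
                  (*-congˡ (x≈y⇒x∙y⁻¹≈ε (Ψ⇒Z₀+2A₀A₂V₀V₂≈Z₁+2A₁A₃V₀V₂ ψ V₀V₂≈V₁V₃))) ⟩
      0# + A₀ * A₀ * B₁ * 0#
        ≈⟨ trans (+-identityˡ _) (zeroʳ _) ⟩
      0# ∎

  Q≈k*xz : d ≈ 0# → ∀ x z → Q x z ≈ k * (x * z)
  Q≈k*xz d≈0 x z = begin
    Q x z                                                           ≈⟨ solve 6 (λ d k A₀ A₂ x z →
      A₀ :* A₀ :* d :* (x :* x) :+ k :* (x :* z) :+ A₂ :* A₂ :* d :* (z :* z) :=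
      d :* (A₀ :* A₀ :* (x :* x) :+ A₂ :* A₂ :* (z :* z)) :+ k :* (x :* z)) refl d k A₀ A₂ x z ⟩
    d * (A₀ * A₀ * (x * x) + A₂ * A₂ * (z * z)) + k * (x * z)       ≈⟨ +-congʳ (trans (*-congʳ d≈0) (zeroˡ _)) ⟩
    0# + k * (x * z)                                                 ≈⟨ +-identityˡ _ ⟩
    k * (x * z)                                                      ∎

module FieldLemmas {c ℓ : Level} (F : CommutativeRing c ℓ) (isField : FieldDefs.IsField F) where
  open CommutativeRing F
  open FieldDefs F using (_^_; module IsField)
  open IsField isField
  open RingLemmas F using (quadraticForm)
  open import Algebra.Definitions _≈_ using (AlmostLeftCancellative; AlmostRightCancellative)
  open import Algebra.Consequences.Setoid setoid using (comm∧almostCancelˡ⇒almostCancelʳ)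
  open import Algebra.Properties.Ring ring using (x≈y⇒x∙y⁻¹≈ε; x∙y⁻¹≈ε⇒x≈y; +-inverseˡ-unique)
  open IntegerCoefficientSolver F using (solve; _:+_; _:-_; _:*_; _:=_)
  open import Relation.Binary.Reasoning.Setoid setoid

  *-cancelˡ-nonZero : AlmostLeftCancellative 0# _*_
  *-cancelˡ-nonZero x y z x≉0 xy≈xz with inverse x x≉0
  ... | x⁻¹ , xx⁻¹≈1 = begin
    y              ≈⟨ *-identityˡ y ⟨
    1# * y         ≈⟨ *-congʳ x⁻¹x≈1 ⟨
    x⁻¹ * x * y    ≈⟨ *-assoc x⁻¹ x y ⟩
    x⁻¹ * (x * y)  ≈⟨ *-congˡ xy≈xz ⟩
    x⁻¹ * (x * z)  ≈⟨ *-assoc x⁻¹ x z ⟨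
    x⁻¹ * x * z    ≈⟨ *-congʳ x⁻¹x≈1 ⟩
    1# * z         ≈⟨ *-identityˡ z ⟩
    z              ∎
    where
    x⁻¹x≈1 : x⁻¹ * x ≈ 1#
    x⁻¹x≈1 = trans (*-comm x⁻¹ x) xx⁻¹≈1

  *-cancelʳ-nonZero : AlmostRightCancellative 0# _*_
  *-cancelʳ-nonZero = comm∧almostCancelˡ⇒almostCancelʳ *-comm *-cancelˡ-nonZero

  x≉0∧xy≈0⇒y≈0 : ∀ {x y} → x ≉ 0# → x * y ≈ 0# → y ≈ 0#
  x≉0∧xy≈0⇒y≈0 {x} {y} x≉0 xy≈0 = *-cancelˡ-nonZero x y 0# x≉0 (trans xy≈0 (sym (zeroʳ x)))

  y≉0∧xy≈0⇒x≈0 : ∀ {x y} → y ≉ 0# → x * y ≈ 0# → x ≈ 0#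
  y≉0∧xy≈0⇒x≈0 {x} {y} y≉0 xy≈0 = x≉0∧xy≈0⇒y≈0 y≉0 (trans (*-comm y x) xy≈0)

  x≉0∧y≉0⇒xy≉0 : ∀ {x y} → x ≉ 0# → y ≉ 0# → x * y ≉ 0#
  x≉0∧y≉0⇒xy≉0 x≉0 y≉0 = y≉0 ∘ x≉0∧xy≈0⇒y≈0 x≉0

  x≉0⇒x^n≉0 : ∀ {x} n → x ≉ 0# → x ^ n ≉ 0#
  x≉0⇒x^n≉0 zero    _   = 0≉1 ∘ sym
  x≉0⇒x^n≉0 (suc n) x≉0 = x≉0∧y≉0⇒xy≉0 x≉0 (x≉0⇒x^n≉0 n x≉0)

  x≉y⇒x-y≉0 : ∀ {x y} → x ≉ y → x - y ≉ 0#
  x≉y⇒x-y≉0 {x} {y} x≉y = x≉y ∘ x∙y⁻¹≈ε⇒x≈y x y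

  x+x≈0⇒x≈0 : 1# + 1# ≉ 0# → ∀ {x} → x + x ≈ 0# → x ≈ 0#
  x+x≈0⇒x≈0 2≉0 {x} x+x≈0 = x≉0∧xy≈0⇒y≈0 2≉0 (begin
    (1# + 1#) * x   ≈⟨ distribʳ x 1# 1# ⟩
    1# * x + 1# * x ≈⟨ +-cong (*-identityˡ x) (*-identityˡ x) ⟩
    x + x           ≈⟨ x+x≈0 ⟩
    0#              ∎)

  x*x≈1⇒x≈-1 : ∀ {x} → x * x ≈ 1# → x ≉ 1# → x ≈ - 1#
  x*x≈1⇒x≈-1 {x} x*x≈1 x≉1 = +-inverseˡ-unique x 1# (x≉0∧xy≈0⇒y≈0 (x≉y⇒x-y≉0 x≉1) (begin
    (x - 1#) * (x + 1#) ≈⟨ solve 2 (λ x o → (x :- o) :* (x :+ o) := x :* x :- o :* o) refl x 1# ⟩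
    x * x - 1# * 1#     ≈⟨ x≈y⇒x∙y⁻¹≈ε (trans x*x≈1 (sym (*-identityˡ 1#))) ⟩
    0#                  ∎))

  quadraticForm-threeZeros⇒a≈0 :
    ∀ {a b c x₁ z₁ x₂ z₂ x₃ z₃} →
    x₁ * z₂ ≉ x₂ * z₁ → x₂ * z₃ ≉ x₃ * z₂ → x₃ * z₁ ≉ x₁ * z₃ →
    quadraticForm a b c x₁ z₁ ≈ 0# → quadraticForm a b c x₂ z₂ ≈ 0# → quadraticForm a b c x₃ z₃ ≈ 0# →
    a ≈ 0#
  quadraticForm-threeZeros⇒a≈0 {a} {b} {c} {x₁} {z₁} {x₂} {z₂} {x₃} {z₃} ≉₁₂ ≉₂₃ ≉₃₁ Q₁≈0 Q₂≈0 Q₃≈0 =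
    *-cancelʳ-nonZero Δ a 0# Δ≉0 (begin
      a * Δ                                  ≈⟨ cramer ⟩
      C₁ * Q₁ + C₂ * Q₂ + C₃ * Q₃            ≈⟨ +-cong (+-cong (*-congˡ Q₁≈0) (*-congˡ Q₂≈0)) (*-congˡ Q₃≈0) ⟩
      C₁ * 0# + C₂ * 0# + C₃ * 0#            ≈⟨ +-cong (+-cong (zeroʳ C₁) (zeroʳ C₂)) (zeroʳ C₃) ⟩
      0# + 0# + 0#                           ≈⟨ trans (+-identityʳ _) (+-identityʳ 0#) ⟩
      0#                                     ≈⟨ zeroˡ Δ ⟨
      0# * Δ                                 ∎)
    where
    Q₁ Q₂ Q₃ Δ C₁ C₂ C₃ : Carrier
    Q₁ = quadraticForm a b c x₁ z₁
    Q₂ = quadraticForm a b c x₂ z₂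
    Q₃ = quadraticForm a b c x₃ z₃
    Δ  = (x₁ * z₂ - x₂ * z₁) * (x₂ * z₃ - x₃ * z₂) * (x₃ * z₁ - x₁ * z₃)
    C₁ = z₂ * z₃ * (x₃ * z₂ - x₂ * z₃)
    C₂ = z₁ * z₃ * (x₁ * z₃ - x₃ * z₁)
    C₃ = z₁ * z₂ * (x₂ * z₁ - x₁ * z₂)

    Δ≉0 : Δ ≉ 0#
    Δ≉0 = x≉0∧y≉0⇒xy≉0 (x≉0∧y≉0⇒xy≉0 (x≉y⇒x-y≉0 ≉₁₂) (x≉y⇒x-y≉0 ≉₂₃)) (x≉y⇒x-y≉0 ≉₃₁)

    -- Cramer's rule: the Cᵢ are the cofactors of the first column of the matrix with rows
    -- (xᵢ², xᵢzᵢ, zᵢ²), whose determinant is Δ.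
    cramer : a * Δ ≈ C₁ * Q₁ + C₂ * Q₂ + C₃ * Q₃
    cramer = solve 9 (λ a b c x₁ z₁ x₂ z₂ x₃ z₃ →
      let Q : _ → _ → _
          Q x z = a :* (x :* x) :+ b :* (x :* z) :+ c :* (z :* z)
      in a :* ((x₁ :* z₂ :- x₂ :* z₁) :* (x₂ :* z₃ :- x₃ :* z₂) :* (x₃ :* z₁ :- x₁ :* z₃)) :=
           z₂ :* z₃ :* (x₃ :* z₂ :- x₂ :* z₃) :* Q x₁ z₁
        :+ z₁ :* z₃ :* (x₁ :* z₃ :- x₃ :* z₁) :* Q x₂ z₂
        :+ z₁ :* z₂ :* (x₂ :* z₁ :- x₁ :* z₂) :* Q x₃ z₃) refl a b c x₁ z₁ x₂ z₂ x₃ z₃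

-- The field has suc M elements, so the order N ∸ 1 in IsPrimitiveOfOrder computes to M.
module PrimitiveElement {c ℓ : Level} (F : CommutativeRing c ℓ) (isField : FieldDefs.IsField F)
                        (M : ℕ) {{M≢0 : NonZero M}} (α : CommutativeRing.Carrier F)
                        (prim : FieldDefs.IsPrimitiveOfOrder F (suc M) α) where
  open CommutativeRing F
  open FieldDefs F using (_^_; module IsField; module IsPrimitiveOfOrder)
  open IsField isField using (0≉1)
  open IsPrimitiveOfOrder prim
  open RingLemmas F using (^-homo-*; ^-assocʳ; ^-congˡ)
  open FieldLemmas F isField using (*-cancelˡ-nonZero; x≉0∧xy≈0⇒y≈0; x≉0⇒x^n≉0; x*x≈1⇒x≈-1)
  open import Algebra.Properties.Ring ring using (+-inverseˡ-unique)
  open import Relation.Binary.Reasoning.Setoid setoid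

  α≉0 : α ≉ 0#
  α≉0 α≈0 = 0≉1 (begin
    0#                       ≈⟨ zeroˡ _ ⟨
    0# * α ^ ℕ.pred M        ≈⟨ *-congʳ α≈0 ⟨
    α ^ suc (ℕ.pred M)       ≡⟨ ≡.cong (α ^_) (ℕₚ.suc-pred M) ⟩
    α ^ M                    ≈⟨ order-eq ⟩
    1#                       ∎)

  α^k≉0 : ∀ k → α ^ k ≉ 0#
  α^k≉0 k = x≉0⇒x^n≉0 k α≉0

  ≈0? : ∀ x → Dec (x ≈ 0#)
  ≈0? x with covers x
  ... | inj₁ x≈0             = yes x≈0
  ... | inj₂ (j , _ , x≈α^j) = no (α^k≉0 j ∘ trans (sym x≈α^j))

  xy≈0⇒x≈0∨y≈0 : ∀ {x y} → x * y ≈ 0# → x ≈ 0# ⊎ y ≈ 0#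
  xy≈0⇒x≈0∨y≈0 {x} xy≈0 with ≈0? x
  ... | yes x≈0 = inj₁ x≈0
  ... | no  x≉0 = inj₂ (x≉0∧xy≈0⇒y≈0 x≉0 xy≈0)

  α^[x+k*M]≈α^x : ∀ x k → α ^ (x ℕ.+ k ℕ.* M) ≈ α ^ x
  α^[x+k*M]≈α^x x k = begin
    α ^ (x ℕ.+ k ℕ.* M)      ≈⟨ ^-homo-* α x (k ℕ.* M) ⟩
    α ^ x * α ^ (k ℕ.* M)    ≡⟨ ≡.cong (λ e → α ^ x * α ^ e) (ℕₚ.*-comm k M) ⟩
    α ^ x * α ^ (M ℕ.* k)    ≈⟨ *-congˡ (^-assocʳ α M k) ⟨
    α ^ x * (α ^ M) ^ k      ≈⟨ *-congˡ (trans (^-congˡ k order-eq) (1^k≈1 k)) ⟩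
    α ^ x * 1#               ≈⟨ *-identityʳ _ ⟩
    α ^ x                    ∎
    where
    1^k≈1 : ∀ k → 1# ^ k ≈ 1#
    1^k≈1 zero    = refl
    1^k≈1 (suc k) = trans (*-identityˡ _) (1^k≈1 k)

  α^x≈1⇒M∣x : ∀ {x} → α ^ x ≈ 1# → M ∣ x
  α^x≈1⇒M∣x {x} α^x≈1 = m%n≡0⇒n∣m x M x%M≡0
    where
    α^[x%M]≈1 : α ^ (x % M) ≈ 1#
    α^[x%M]≈1 = begin
      α ^ (x % M)                    ≈⟨ α^[x+k*M]≈α^x (x % M) (x / M) ⟨
      α ^ (x % M ℕ.+ x / M ℕ.* M)    ≡⟨ ≡.cong (α ^_) (m≡m%n+[m/n]*n x M) ⟨
      α ^ x                          ≈⟨ α^x≈1 ⟩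
      1#                             ∎

    x%M≡0 : x % M ≡ 0
    x%M≡0 with x % M | m%n<n x M | α^[x%M]≈1
    ... | zero  | _   | _     = ≡.refl
    ... | suc r | r<M | α^r≈1 = ⊥-elim (order-min (suc r) z<s r<M α^r≈1)

  α^[x+d]≈α^x⇒M∣d : ∀ {x d} → α ^ (x ℕ.+ d) ≈ α ^ x → M ∣ d
  α^[x+d]≈α^x⇒M∣d {x} {d} α^[x+d]≈α^x = α^x≈1⇒M∣x (*-cancelˡ-nonZero (α ^ x) (α ^ d) 1# (α^k≉0 x) (begin
    α ^ x * α ^ d   ≈⟨ ^-homo-* α x d ⟨
    α ^ (x ℕ.+ d)   ≈⟨ α^[x+d]≈α^x ⟩
    α ^ x           ≈⟨ *-identityʳ _ ⟨
    α ^ x * 1#      ∎))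

  α^-cancelˡ : ∀ x {y z} → α ^ (x ℕ.+ y) ≈ α ^ (x ℕ.+ z) → α ^ y ≈ α ^ z
  α^-cancelˡ x {y} {z} eq = *-cancelˡ-nonZero (α ^ x) (α ^ y) (α ^ z) (α^k≉0 x)
    (trans (sym (^-homo-* α x y)) (trans eq (^-homo-* α x z)))

  α^-injective-≤ : ∀ {x y} → x ℕ.≤ y → y ℕ.< M → α ^ x ≈ α ^ y → x ≡ y
  α^-injective-≤ {x} {y} x≤y y<M α^x≈α^y = ℕₚ.≤-antisym x≤y (ℕₚ.m∸n≡0⇒m≤n y∸x≡0)
    where
    M∣y∸x : M ∣ y ℕ.∸ x
    M∣y∸x = α^[x+d]≈α^x⇒M∣d {x} (trans (reflexive (≡.cong (α ^_) (ℕₚ.m+[n∸m]≡n x≤y))) (sym α^x≈α^y))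
    y∸x≡0 : y ℕ.∸ x ≡ 0
    y∸x≡0 = ≡.trans (≡.sym (m<n⇒m%n≡m (ℕₚ.≤-<-trans (ℕₚ.m∸n≤m y x) y<M))) (n∣m⇒m%n≡0 (y ℕ.∸ x) M M∣y∸x)

  α^-injective : ∀ {x y} → x ℕ.< M → y ℕ.< M → α ^ x ≈ α ^ y → x ≡ y
  α^-injective {x} {y} x<M y<M α^x≈α^y with ℕₚ.≤-total x y
  ... | inj₁ x≤y = α^-injective-≤ x≤y y<M α^x≈α^y
  ... | inj₂ y≤x = ≡.sym (α^-injective-≤ y≤x x<M (sym α^x≈α^y))

  [α^x]^[1+M]≈α^x : ∀ x → (α ^ x) ^ suc M ≈ α ^ x
  [α^x]^[1+M]≈α^x x = begin
    (α ^ x) ^ suc M        ≈⟨ ^-assocʳ α x (suc M) ⟩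
    α ^ (x ℕ.* suc M)      ≡⟨ ≡.cong (α ^_) (ℕₚ.*-suc x M) ⟩
    α ^ (x ℕ.+ x ℕ.* M)    ≈⟨ α^[x+k*M]≈α^x x x ⟩
    α ^ x                  ∎

  module _ {h} (h+h≡M : h ℕ.+ h ≡ M) where
    private
      0<h : 0 ℕ.< h
      0<h = ℕₚ.n≢0⇒n>0 (λ h≡0 → ℕ.≢-nonZero⁻¹ M (≡.trans (≡.sym h+h≡M) (≡.cong (λ k → k ℕ.+ k) h≡0)))

      α^h≉1 : α ^ h ≉ 1#
      α^h≉1 = order-min h 0<h (≡.subst (h ℕ.<_) h+h≡M (ℕₚ.m<m+n h 0<h))

    α^h≈-1 : α ^ h ≈ - 1#
    α^h≈-1 = x*x≈1⇒x≈-1 α^h*α^h≈1 α^h≉1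
      where
      α^h*α^h≈1 : α ^ h * α ^ h ≈ 1#
      α^h*α^h≈1 = trans (sym (^-homo-* α h h)) (trans (reflexive (≡.cong (α ^_) h+h≡M)) order-eq)

    1+1≉0 : 1# + 1# ≉ 0#
    1+1≉0 1+1≈0 = α^h≉1 (trans α^h≈-1 (sym (+-inverseˡ-unique 1# 1# 1+1≈0)))

module OddNumbers where
  open import Data.Nat using (_+_; _*_; _^_)
  open ≡.≡-Reasoning

  2∤p^k : ∀ {p} k → Prime p → p ≢ 2 → 2 ∤ p ^ k
  2∤p^k zero    _  _   2∣1 with () ← ∣1⇒≡1 2∣1
  2∤p^k {p} (suc k) pp p≢2 2∣p*p^k with euclidsLemma p (p ^ k) prime[2] 2∣p*p^k
  ... | inj₁ 2∣p   = [ (λ ()) , p≢2 ∘ ≡.sym ]′ (prime⇒irreducible pp 2∣p)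
  ... | inj₂ 2∣p^k = 2∤p^k k pp p≢2 2∣p^k

  odd⇒≡1+2*[n/2] : ∀ n → 2 ∤ n → n ≡ 1 + 2 * (n / 2)
  odd⇒≡1+2*[n/2] n 2∤n = begin
    n                    ≡⟨ m≡m%n+[m/n]*n n 2 ⟩
    n % 2 + n / 2 * 2    ≡⟨ ≡.cong₂ _+_ n%2≡1 (ℕₚ.*-comm (n / 2) 2) ⟩
    1 + 2 * (n / 2)      ∎
    where
    n%2≡1 : n % 2 ≡ 1
    n%2≡1 with n % 2 | m%n<n n 2 | m%n≡0⇒n∣m n 2
    ... | 0           | _                | 2∣n = ⊥-elim (2∤n (2∣n ≡.refl))
    ... | 1           | _                | _   = ≡.refl
    ... | suc (suc _) | s≤s (s≤s ())     | _

  oddPrimePower⇒≡1+2t : ∀ {q} → OddPrimePower q → ∃[ t ] NonZero t × q ≡ 1 + 2 * t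
  oddPrimePower⇒≡1+2t     (_ , zero  , _  , _   , ()    , _)
  oddPrimePower⇒≡1+2t {q} (p , suc k , pp , p≢2 , _ , q≡p^k) = q / 2 , ℕ.≢-nonZero q/2≢0 , q≡1+2t
    where
    q≡1+2t : q ≡ 1 + 2 * (q / 2)
    q≡1+2t = odd⇒≡1+2*[n/2] q (≡.subst (2 ∤_) (≡.sym q≡p^k) (2∤p^k (suc k) pp p≢2))

    q/2≢0 : q / 2 ≢ 0
    q/2≢0 q/2≡0 = ¬prime[1] (≡.subst Prime (ℕₚ.m*n≡1⇒m≡1 p (p ^ k) p^[1+k]≡1) pp)
      where
      p^[1+k]≡1 : p ^ suc k ≡ 1
      p^[1+k]≡1 = ≡.trans (≡.sym q≡p^k) (≡.trans q≡1+2t (≡.cong (λ t → 1 + 2 * t) q/2≡0))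

module OddArithmetic (t : ℕ) {{t≢0 : NonZero t}} where
  open import Data.Nat using (_+_; _*_; _∸_; _^_; _<_; _≤_)
  open import Data.Nat.Solver using (module +-*-Solver)
  open +-*-Solver using (solve; Polynomial; _:+_; _:*_; _:^_; _:=_; con)

  q n M W : ℕ
  q = 1 + 2 * t
  n = (q ^ 2 + 1) * (q + 1)
  M = 2 * t * n
  W = 1 + 2 * t * (1 + t)

  g : ℕ → ℕ
  g i = i * (q + 1)

  instance
    2t≢0 : NonZero (2 * t)
    2t≢0 = ℕₚ.m*n≢0 2 t

    M≢0 : NonZero M
    M≢0 = ℕₚ.m*n≢0 (2 * t) n

  private
    q̂ n̂ : ∀ {k} → Polynomial k → Polynomial k
    q̂ t = con 1 :+ con 2 :* t
    n̂ t = (q̂ t :^ 2 :+ con 1) :* (q̂ t :+ con 1)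

  q^4≡1+M : q ^ 4 ≡ suc M
  q^4≡1+M = solve 1 (λ t → q̂ t :^ 4 := con 1 :+ con 2 :* t :* n̂ t) ≡.refl t

  [q²+1]/2≡W : (q ^ 2 + 1) / 2 ≡ W
  [q²+1]/2≡W = ≡.trans (≡.cong (_/ 2) q²+1≡W*2) (m*n/n≡m W 2)
    where
    q²+1≡W*2 : q ^ 2 + 1 ≡ W * 2
    q²+1≡W*2 = solve 1 (λ t → q̂ t :^ 2 :+ con 1 := (con 1 :+ con 2 :* t :* (con 1 :+ t)) :* con 2) ≡.refl t

  tn+tn≡M : t * n + t * n ≡ M
  tn+tn≡M = solve 1 (λ t → t :* n̂ t :+ t :* n̂ t := con 2 :* t :* n̂ t) ≡.refl t

  tn<M : t * n < M
  tn<M = ≡.subst (t * n <_) tn+tn≡M (ℕₚ.m<m+n (t * n) (ℕ.>-nonZero⁻¹ (t * n) {{ℕₚ.m*n≢0 t n}}))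

  2ts<M : ∀ {s} → s < n → 2 * t * s < M
  2ts<M = ℕₚ.*-monoʳ-< (2 * t)

  2ts≡tn⇒n/2≡s : ∀ {s} → 2 * t * s ≡ t * n → n / 2 ≡ s
  2ts≡tn⇒n/2≡s {s} 2ts≡tn = ≡.trans (≡.cong (_/ 2) n≡s*2) (m*n/n≡m s 2)
    where
    n≡s*2 : n ≡ s * 2
    n≡s*2 = ≡.sym (ℕₚ.*-cancelˡ-≡ (s * 2) n t
              (≡.trans (solve 2 (λ t s → t :* (s :* con 2) := con 2 :* t :* s) ≡.refl t s) 2ts≡tn))

  s*q≡s+2ts : ∀ s → s * q ≡ s + 2 * t * s
  s*q≡s+2ts s = solve 2 (λ t s → s :* q̂ t := s :+ con 2 :* t :* s) ≡.refl t s

  i*n*q≡i*n+i*M : ∀ i → i * n * q ≡ i * n + i * M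
  i*n*q≡i*n+i*M i = solve 2 (λ t i → i :* n̂ t :* q̂ t := i :* n̂ t :+ i :* (con 2 :* t :* n̂ t)) ≡.refl t i

  g+g*q²≡i*n : ∀ i → g i + g i * q ^ 2 ≡ i * n
  g+g*q²≡i*n i = solve 2 (λ t i → i :* (q̂ t :+ con 1) :+ i :* (q̂ t :+ con 1) :* q̂ t :^ 2 := i :* n̂ t) ≡.refl t i

  2*i*[q+1]≡g+g : ∀ i → 2 * i * (q + 1) ≡ g i + g i
  2*i*[q+1]≡g+g i = solve 2 (λ t i → con 2 :* i :* (q̂ t :+ con 1) := i :* (q̂ t :+ con 1) :+ i :* (q̂ t :+ con 1)) ≡.refl t i

  2*i*[q+1]*p≡g*p+g*p : ∀ i p → 2 * i * (q + 1) * p ≡ g i * p + g i * p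
  2*i*[q+1]*p≡g*p+g*p i p = solve 3 (λ t i p →
    con 2 :* i :* (q̂ t :+ con 1) :* p := i :* (q̂ t :+ con 1) :* p :+ i :* (q̂ t :+ con 1) :* p) ≡.refl t i p

  crossExponent : ∀ {i j} → i ≤ j → g i + g j * q ^ 2 ≡ (g j + g i * q ^ 2) + 2 * t * (q + 1) * g (j ∸ i)
  crossExponent {i} {j} i≤j = ≡.subst (λ j′ → g i + g j′ * q ^ 2 ≡ (g j′ + g i * q ^ 2) + 2 * t * (q + 1) * g (j ∸ i))
    (ℕₚ.m+[n∸m]≡n i≤j)
    (solve 3 (λ t i δ →
      i :* (q̂ t :+ con 1) :+ (i :+ δ) :* (q̂ t :+ con 1) :* q̂ t :^ 2 :=
      ((i :+ δ) :* (q̂ t :+ con 1) :+ i :* (q̂ t :+ con 1) :* q̂ t :^ 2) :+ con 2 :* t :* (q̂ t :+ con 1) :* (δ :* (q̂ t :+ con 1)))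
      ≡.refl t i (j ∸ i))

  W⊥1+t : Coprime W (1 + t)
  W⊥1+t {d} (d∣W , d∣1+t) =
    ∣1⇒≡1 (∣m+n∣m⇒∣n (≡.subst (d ∣_) (ℕₚ.+-comm 1 (2 * t * (1 + t))) d∣W) (∣n⇒∣m*n (2 * t) d∣1+t))

  -- M = 2t(q + 1)(q² + 1), q² + 1 = 2W and q + 1 = 2(1 + t), so M ∣ 2t(q + 1) g δ forces W ∣ δ.
  M∤2t[q+1]gδ : ∀ {δ} → 0 < δ → δ < W → M ∤ 2 * t * (q + 1) * g δ
  M∤2t[q+1]gδ {δ} 0<δ δ<W M∣2t[q+1]gδ = ℕₚ.<⇒≱ δ<W (∣⇒≤ {{ℕ.>-nonZero 0<δ}} W∣δ)
    where
    instance
      2t[q+1]≢0 : NonZero (2 * t * (q + 1))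
      2t[q+1]≢0 = ℕₚ.m*n≢0 (2 * t) (q + 1)

    M≡2t[q+1][q²+1] : M ≡ 2 * t * (q + 1) * (q ^ 2 + 1)
    M≡2t[q+1][q²+1] = solve 1 (λ t → con 2 :* t :* n̂ t := con 2 :* t :* (q̂ t :+ con 1) :* (q̂ t :^ 2 :+ con 1)) ≡.refl t

    q²+1∣gδ : q ^ 2 + 1 ∣ g δ
    q²+1∣gδ = *-cancelˡ-∣ (2 * t * (q + 1)) (≡.subst (_∣ 2 * t * (q + 1) * g δ) M≡2t[q+1][q²+1] M∣2t[q+1]gδ)

    W∣[1+t]δ : W ∣ (1 + t) * δ
    W∣[1+t]δ = *-cancelˡ-∣ 2 (≡.subst₂ _∣_
      (solve 1 (λ t → q̂ t :^ 2 :+ con 1 := con 2 :* (con 1 :+ con 2 :* t :* (con 1 :+ t))) ≡.refl t)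
      (solve 2 (λ t δ → δ :* (q̂ t :+ con 1) := con 2 :* ((con 1 :+ t) :* δ)) ≡.refl t δ)
      q²+1∣gδ)

    W∣δ : W ∣ δ
    W∣δ = coprime-divisor W⊥1+t W∣[1+t]δ

module Intersection {c ℓ : Level} (F : CommutativeRing c ℓ) (isField : FieldDefs.IsField F)
                     (t : ℕ) {{t≢0 : NonZero t}} (α : CommutativeRing.Carrier F)
                     (prim : FieldDefs.IsPrimitiveOfOrder F (OddArithmetic.q t ℕ.^ 4) α)
                     (s u : ℕ) where
  open CommutativeRing F
  open FieldDefs F using (_^_; IsPrimitiveOfOrder; Tr; Alt; OnPlane; OnΨ; InOePΨ)
  open OddArithmetic t
  open RingLemmas F
  open FieldLemmas F isField
    using (x≉0∧xy≈0⇒y≈0; y≉0∧xy≈0⇒x≈0; x≉0∧y≉0⇒xy≉0; x≉0⇒x^n≉0; x+x≈0⇒x≈0; quadraticForm-threeZeros⇒a≈0)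
  open import Algebra.Properties.Ring ring using (-‿involutive; -1*x≈-x; +-inverseʳ-unique; x∙y⁻¹≈ε⇒x≈y)
  open import Relation.Binary.Reasoning.Setoid setoid

  prim′ : IsPrimitiveOfOrder (suc M) α
  prim′ = ≡.subst (λ N → IsPrimitiveOfOrder N α) q^4≡1+M prim

  open PrimitiveElement F isField M α prim′

  a b A₁ A₂ A₃ B₁ B₂ B₃ : Carrier
  a  = α ^ s
  b  = α ^ u
  A₁ = a ^ q
  A₂ = a ^ (q ℕ.^ 2)
  A₃ = a ^ (q ℕ.^ 3)
  B₁ = b ^ q
  B₂ = b ^ (q ℕ.^ 2)
  B₃ = b ^ (q ℕ.^ 3)

  open IntersectionForm F a A₁ A₂ A₃ b B₁ B₂ B₃ using (d; k; Q; plane∧Ψ⇒Q≈0; Q≈k*xz)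

  [xyz]^q≈x^qy^qz^q : ∀ x y z → (x * y * z) ^ q ≈ x ^ q * y ^ q * z ^ q
  [xyz]^q≈x^qy^qz^q x y z = trans (^-distrib-* (x * y) z q) (*-congʳ (^-distrib-* x y q))

  a²B₂≈A₂²b : a ^ 2 * B₂ ≈ a ^ (2 ℕ.* q ℕ.^ 2) * b → a * a * B₂ ≈ A₂ * A₂ * b
  a²B₂≈A₂²b H = begin
    a * a * B₂                   ≈⟨ *-congʳ (*-congˡ (*-identityʳ a)) ⟨
    a ^ 2 * B₂                   ≈⟨ H ⟩
    a ^ (2 ℕ.* q ℕ.^ 2) * b      ≈⟨ *-congʳ (^-assocʳ a 2 (q ℕ.^ 2)) ⟨
    (a ^ 2) ^ (q ℕ.^ 2) * b      ≈⟨ *-congʳ (^-congˡ (q ℕ.^ 2) (*-congˡ (*-identityʳ a))) ⟩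
    (a * a) ^ (q ℕ.^ 2) * b      ≈⟨ *-congʳ (^-distrib-* a a (q ℕ.^ 2)) ⟩
    A₂ * A₂ * b                  ∎

  A₁²B₃≈A₃²B₁ : a * a * B₂ ≈ A₂ * A₂ * b → A₁ * A₁ * B₃ ≈ A₃ * A₃ * B₁
  A₁²B₃≈A₃²B₁ a²B₂≈A₂²b = begin
    A₁ * A₁ * B₃                 ≈⟨ *-congˡ ([x^[p^k]]^p≈x^[p^[1+k]] b q 2) ⟨
    A₁ * A₁ * B₂ ^ q             ≈⟨ [xyz]^q≈x^qy^qz^q a a B₂ ⟨
    (a * a * B₂) ^ q             ≈⟨ ^-congˡ q a²B₂≈A₂²b ⟩
    (A₂ * A₂ * b) ^ q            ≈⟨ [xyz]^q≈x^qy^qz^q A₂ A₂ b ⟩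
    A₂ ^ q * A₂ ^ q * B₁         ≈⟨ *-congʳ (*-cong ([x^[p^k]]^p≈x^[p^[1+k]] a q 2) ([x^[p^k]]^p≈x^[p^[1+k]] a q 2)) ⟩
    A₃ * A₃ * B₁                 ∎

  A₃^q≈a : A₃ ^ q ≈ a
  A₃^q≈a = begin
    A₃ ^ q                       ≈⟨ [x^[p^k]]^p≈x^[p^[1+k]] a q 3 ⟩
    a ^ (q ℕ.^ 4)                ≡⟨ ≡.cong (a ^_) q^4≡1+M ⟩
    a ^ suc M                    ≈⟨ [α^x]^[1+M]≈α^x s ⟩
    a                            ∎

  -- The point ω(2i(q+1)) of O^(e) is (v² : V₁² : V₂² : V₃²), and the w of the context is a v.
  module Point (i : ℕ) where
    v V₁ V₂ V₃ : Carrier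
    v  = α ^ g i
    V₁ = v ^ q
    V₂ = v ^ (q ℕ.^ 2)
    V₃ = v ^ (q ℕ.^ 3)

    onPlane⇒bv²+ΣBₖVₖ²≈0 : OnPlane q α b (2 ℕ.* i ℕ.* (q ℕ.+ 1)) →
               b * (v * v) + B₁ * (V₁ * V₁) + B₂ * (V₂ * V₂) + B₃ * (V₃ * V₃) ≈ 0#
    onPlane⇒bv²+ΣBₖVₖ²≈0 = trans (sym (+-cong (+-cong (+-cong (*-congˡ α^l≈v²) (*-congˡ (α^lp≈[v^p]² q)))
                                          (*-congˡ (α^lp≈[v^p]² (q ℕ.^ 2)))) (*-congˡ (α^lp≈[v^p]² (q ℕ.^ 3)))))
      where
      α^l≈v² : α ^ (2 ℕ.* i ℕ.* (q ℕ.+ 1)) ≈ v * v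
      α^l≈v² = trans (reflexive (≡.cong (α ^_) (2*i*[q+1]≡g+g i))) (^-homo-* α (g i) (g i))

      α^lp≈[v^p]² : ∀ p → α ^ (2 ℕ.* i ℕ.* (q ℕ.+ 1) ℕ.* p) ≈ v ^ p * v ^ p
      α^lp≈[v^p]² p = begin
        α ^ (2 ℕ.* i ℕ.* (q ℕ.+ 1) ℕ.* p)     ≡⟨ ≡.cong (α ^_) (2*i*[q+1]*p≡g*p+g*p i p) ⟩
        α ^ (g i ℕ.* p ℕ.+ g i ℕ.* p)         ≈⟨ ^-homo-* α (g i ℕ.* p) (g i ℕ.* p) ⟩
        α ^ (g i ℕ.* p) * α ^ (g i ℕ.* p)     ≈⟨ *-cong (^-assocʳ α (g i) p) (^-assocʳ α (g i) p) ⟨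
        v ^ p * v ^ p                         ∎

    onΨ⇒[av+A₂V₂]²≈[A₁V₁+A₃V₃]² : OnΨ q α s i →
      (a * v + A₂ * V₂) * (a * v + A₂ * V₂) ≈ (A₁ * V₁ + A₃ * V₃) * (A₁ * V₁ + A₃ * V₃)
    onΨ⇒[av+A₂V₂]²≈[A₁V₁+A₃V₃]² = [p₀+p₂]²≈[p₁+p₃]² _ _ _ _ ∘ Sum.map (trans (sym Tr≈)) (trans (sym Alt≈))
      where
      w : Carrier
      w = α ^ (s ℕ.+ g i)

      w≈av : w ≈ a * v
      w≈av = ^-homo-* α s (g i)

      w^p≈a^pv^p : ∀ p → w ^ p ≈ a ^ p * v ^ p
      w^p≈a^pv^p p = trans (^-congˡ p w≈av) (^-distrib-* a v p)

      Tr≈ : Tr q w ≈ a * v + A₁ * V₁ + A₂ * V₂ + A₃ * V₃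
      Tr≈ = +-cong (+-cong (+-cong w≈av (w^p≈a^pv^p q)) (w^p≈a^pv^p (q ℕ.^ 2))) (w^p≈a^pv^p (q ℕ.^ 3))

      Alt≈ : Alt q w ≈ a * v - A₁ * V₁ + A₂ * V₂ - A₃ * V₃
      Alt≈ = +-cong (+-cong (+-cong w≈av (-‿cong (w^p≈a^pv^p q))) (w^p≈a^pv^p (q ℕ.^ 2))) (-‿cong (w^p≈a^pv^p (q ℕ.^ 3)))

    v*V₂≈α^[i*n] : v * V₂ ≈ α ^ (i ℕ.* n)
    v*V₂≈α^[i*n] = begin
      v * V₂                          ≈⟨ *-congˡ (^-assocʳ α (g i) (q ℕ.^ 2)) ⟩
      v * α ^ (g i ℕ.* q ℕ.^ 2)       ≈⟨ ^-homo-* α (g i) (g i ℕ.* q ℕ.^ 2) ⟨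
      α ^ (g i ℕ.+ g i ℕ.* q ℕ.^ 2)   ≡⟨ ≡.cong (α ^_) (g+g*q²≡i*n i) ⟩
      α ^ (i ℕ.* n)                 ∎

    v*V₂≈V₁*V₃ : v * V₂ ≈ V₁ * V₃
    v*V₂≈V₁*V₃ = begin
      v * V₂                        ≈⟨ v*V₂≈α^[i*n] ⟩
      α ^ (i ℕ.* n)                 ≈⟨ α^[x+k*M]≈α^x (i ℕ.* n) i ⟨
      α ^ (i ℕ.* n ℕ.+ i ℕ.* M)     ≡⟨ ≡.cong (α ^_) (i*n*q≡i*n+i*M i) ⟨
      α ^ (i ℕ.* n ℕ.* q)           ≈⟨ ^-assocʳ α (i ℕ.* n) q ⟨
      (α ^ (i ℕ.* n)) ^ q           ≈⟨ ^-congˡ q v*V₂≈α^[i*n] ⟨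
      (v * V₂) ^ q                  ≈⟨ ^-distrib-* v V₂ q ⟩
      V₁ * V₂ ^ q                   ≈⟨ *-congˡ ([x^[p^k]]^p≈x^[p^[1+k]] v q 2) ⟩
      V₁ * V₃                       ∎

    inOePΨ⇒Q≈0 : a * a * B₂ ≈ A₂ * A₂ * b → InOePΨ q α s b i → Q v V₂ ≈ 0#
    inOePΨ⇒Q≈0 a²B₂≈A₂²b (_ , onPlane , onΨ) =
      plane∧Ψ⇒Q≈0 a²B₂≈A₂²b (A₁²B₃≈A₃²B₁ a²B₂≈A₂²b)
        (onPlane⇒bv²+ΣBₖVₖ²≈0 onPlane) (onΨ⇒[av+A₂V₂]²≈[A₁V₁+A₃V₃]² onΨ) v*V₂≈V₁*V₃

  open Point using (v; V₂)

  vᵢV₂ⱼ≈α^[gᵢ+gⱼq²] : ∀ i j → v i * V₂ j ≈ α ^ (g i ℕ.+ g j ℕ.* q ℕ.^ 2)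
  vᵢV₂ⱼ≈α^[gᵢ+gⱼq²] i j = trans (*-congˡ (^-assocʳ α (g j) (q ℕ.^ 2))) (sym (^-homo-* α (g i) (g j ℕ.* q ℕ.^ 2)))

  -- vᵢV₂ⱼ / (vⱼV₂ᵢ) = (α^((q+1)(q²−1)))^(j−i), and α^((q+1)(q²−1)) has order W = (q²+1)/2.
  <⇒vᵢV₂ⱼ≉vⱼV₂ᵢ : ∀ {i j} → i ℕ.< j → j ℕ.< W → v i * V₂ j ≉ v j * V₂ i
  <⇒vᵢV₂ⱼ≉vⱼV₂ᵢ {i} {j} i<j j<W cross≈ = M∤2t[q+1]gδ (ℕₚ.m<n⇒0<n∸m i<j) (ℕₚ.≤-<-trans (ℕₚ.m∸n≤m j i) j<W)
    (α^[x+d]≈α^x⇒M∣d {g j ℕ.+ g i ℕ.* q ℕ.^ 2} (begin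
      α ^ (g j ℕ.+ g i ℕ.* q ℕ.^ 2 ℕ.+ 2 ℕ.* t ℕ.* (q ℕ.+ 1) ℕ.* g (j ℕ.∸ i))
                                    ≡⟨ ≡.cong (α ^_) (crossExponent (ℕₚ.<⇒≤ i<j)) ⟨
      α ^ (g i ℕ.+ g j ℕ.* q ℕ.^ 2) ≈⟨ vᵢV₂ⱼ≈α^[gᵢ+gⱼq²] i j ⟨
      v i * V₂ j                    ≈⟨ cross≈ ⟩
      v j * V₂ i                    ≈⟨ vᵢV₂ⱼ≈α^[gᵢ+gⱼq²] j i ⟩
      α ^ (g j ℕ.+ g i ℕ.* q ℕ.^ 2) ∎))

  ≢⇒vᵢV₂ⱼ≉vⱼV₂ᵢ : ∀ {i j} → i ≢ j → i ℕ.< W → j ℕ.< W → v i * V₂ j ≉ v j * V₂ i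
  ≢⇒vᵢV₂ⱼ≉vⱼV₂ᵢ {i} {j} i≢j i<W j<W with ℕₚ.<-cmp i j
  ... | tri< i<j _ _ = <⇒vᵢV₂ⱼ≉vⱼV₂ᵢ i<j j<W
  ... | tri≈ _ i≡j _ = ⊥-elim (i≢j i≡j)
  ... | tri> _ _ j<i = <⇒vᵢV₂ⱼ≉vⱼV₂ᵢ j<i i<W ∘ sym

  k≈0⇒aA₂≈A₁A₃ : 1# + 1# ≉ 0# → k ≈ 0# → a * A₂ ≈ A₁ * A₃
  k≈0⇒aA₂≈A₁A₃ 2≉0 k≈0 = x∙y⁻¹≈ε⇒x≈y _ _ (x+x≈0⇒x≈0 2≉0 (x≉0∧xy≈0⇒y≈0 a²B₁≉0 k≈0))
    where
    a²B₁≉0 : a * a * B₁ ≉ 0#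
    a²B₁≉0 = x≉0∧y≉0⇒xy≉0 (x≉0∧y≉0⇒xy≉0 (α^k≉0 s) (α^k≉0 s)) (x≉0⇒x^n≉0 q (α^k≉0 u))

  A₃≈-a⇒A₁≈-a : A₃ ≈ - a → A₁ ≈ - a
  A₃≈-a⇒A₁≈-a A₃≈-a = begin
    A₁             ≈⟨ -‿involutive A₁ ⟨
    - - A₁         ≈⟨ -‿cong (-x^[1+2t]≈-[x^[1+2t]] a t) ⟨
    - (- a) ^ q    ≈⟨ -‿cong (^-congˡ q A₃≈-a) ⟨
    - A₃ ^ q       ≈⟨ -‿cong A₃^q≈a ⟩
    - a            ∎

  A₁≈-a : Tr q a ≈ 0# → a * A₂ ≈ A₁ * A₃ → A₁ ≈ - a
  A₁≈-a tr≈0 aA₂≈A₁A₃ = [ +-inverseʳ-unique a A₁ , A₃≈-a⇒A₁≈-a ∘ +-inverseʳ-unique a A₃ ]′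
    (xy≈0⇒x≈0∨y≈0 ([x₀+x₁][x₀+x₃]≈0 a A₁ A₂ A₃ tr≈0 aA₂≈A₁A₃))

  -- −1 = α^(tn) with q = 1 + 2t, so a^q = −a reads α^(2ts) = α^(tn), and both exponents are below M.
  A₁≈-a⇒n/2≡s : s ℕ.< n → A₁ ≈ - a → n / 2 ≡ s
  A₁≈-a⇒n/2≡s s<n A₁≈-a = 2ts≡tn⇒n/2≡s (α^-injective (2ts<M s<n) tn<M (α^-cancelˡ s (begin
    α ^ (s ℕ.+ 2 ℕ.* t ℕ.* s)   ≡⟨ ≡.cong (α ^_) (s*q≡s+2ts s) ⟨
    α ^ (s ℕ.* q)               ≈⟨ ^-assocʳ α s q ⟨
    A₁                          ≈⟨ A₁≈-a ⟩
    - a                         ≈⟨ -1*x≈-x a ⟨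
    - 1# * a                    ≈⟨ *-congʳ (α^h≈-1 {t ℕ.* n} tn+tn≡M) ⟨
    α ^ (t ℕ.* n) * a           ≈⟨ ^-homo-* α (t ℕ.* n) s ⟨
    α ^ (t ℕ.* n ℕ.+ s)         ≡⟨ ≡.cong (α ^_) (ℕₚ.+-comm (t ℕ.* n) s) ⟩
    α ^ (s ℕ.+ t ℕ.* n)         ∎)))

  inOePΨ⇒<W : ∀ {i} → InOePΨ q α s b i → i ℕ.< W
  inOePΨ⇒<W {i} (i<[q²+1]/2 , _) = ≡.subst (i ℕ.<_) [q²+1]/2≡W i<[q²+1]/2

  module _ (H : a ^ 2 * B₂ ≈ a ^ (2 ℕ.* q ℕ.^ 2) * b) where
    inOePΨ⇒Q≈0 : ∀ {i} → InOePΨ q α s b i → Q (v i) (V₂ i) ≈ 0#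
    inOePΨ⇒Q≈0 {i} = Point.inOePΨ⇒Q≈0 i (a²B₂≈A₂²b H)

    threePoints⇒d≈0 : ∀ {i j l} → i ≢ j → j ≢ l → l ≢ i →
                      InOePΨ q α s b i → InOePΨ q α s b j → InOePΨ q α s b l → d ≈ 0#
    threePoints⇒d≈0 i≢j j≢l l≢i pᵢ pⱼ pₗ = x≉0∧xy≈0⇒y≈0 (x≉0∧y≉0⇒xy≉0 (α^k≉0 s) (α^k≉0 s))
      (quadraticForm-threeZeros⇒a≈0 (nonProportional i≢j pᵢ pⱼ) (nonProportional j≢l pⱼ pₗ) (nonProportional l≢i pₗ pᵢ)
                                    (inOePΨ⇒Q≈0 pᵢ) (inOePΨ⇒Q≈0 pⱼ) (inOePΨ⇒Q≈0 pₗ))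
      where
      nonProportional : ∀ {i j} → i ≢ j → InOePΨ q α s b i → InOePΨ q α s b j → v i * V₂ j ≉ v j * V₂ i
      nonProportional i≢j pᵢ pⱼ = ≢⇒vᵢV₂ⱼ≉vⱼV₂ᵢ i≢j (inOePΨ⇒<W pᵢ) (inOePΨ⇒<W pⱼ)

    d≈0∧onePoint⇒k≈0 : d ≈ 0# → ∀ {i} → InOePΨ q α s b i → k ≈ 0#
    d≈0∧onePoint⇒k≈0 d≈0 {i} pᵢ = y≉0∧xy≈0⇒x≈0 vV₂≉0 (trans (sym (Q≈k*xz d≈0 (v i) (V₂ i))) (inOePΨ⇒Q≈0 pᵢ))
      where
      vV₂≉0 : v i * V₂ i ≉ 0#
      vV₂≉0 = x≉0∧y≉0⇒xy≉0 (α^k≉0 (g i)) (x≉0⇒x^n≉0 (q ℕ.^ 2) (α^k≉0 (g i)))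

  k≈0⇒n/2≡s : Tr q a ≈ 0# → s ℕ.< n → k ≈ 0# → n / 2 ≡ s
  k≈0⇒n/2≡s tr≈0 s<n k≈0 = A₁≈-a⇒n/2≡s s<n (A₁≈-a tr≈0 (k≈0⇒aA₂≈A₁A₃ (1+1≉0 {t ℕ.* n} tn+tn≡M) k≈0))

  noThreeDistinctPoints : a ^ 2 * B₂ ≈ a ^ (2 ℕ.* q ℕ.^ 2) * b → Tr q a ≈ 0# → s ℕ.< n → s ≢ n / 2 →
                          ∀ {i j l} → i ≢ j → i ≢ l → j ≢ l →
                          InOePΨ q α s b i → InOePΨ q α s b j → InOePΨ q α s b l → ⊥
  noThreeDistinctPoints H tr≈0 s<n s≢x₀ i≢j i≢l j≢l pᵢ pⱼ pₗ = s≢x₀ (≡.sym (k≈0⇒n/2≡s tr≈0 s<n k≈0))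
    where
    k≈0 : k ≈ 0#
    k≈0 = d≈0∧onePoint⇒k≈0 H (threePoints⇒d≈0 H i≢j j≢l (i≢l ∘ ≡.sym) pᵢ pⱼ pₗ) pᵢ

open import Data.Nat using (_≤_; _^_)

noThreeDistinct⇒length≤2 : ∀ {a p} {A : Set a} {P : A → Set p} →
  (∀ {x y z} → x ≢ y → x ≢ z → y ≢ z → P x → P y → P z → ⊥) →
  ∀ xs → Unique xs → All P xs → length xs ≤ 2
noThreeDistinct⇒length≤2 _ []           _ _ = z≤n
noThreeDistinct⇒length≤2 _ (_ ∷ [])     _ _ = s≤s z≤n
noThreeDistinct⇒length≤2 _ (_ ∷ _ ∷ []) _ _ = s≤s (s≤s z≤n)
noThreeDistinct⇒length≤2 noThree (_ ∷ _ ∷ _ ∷ _) ((x≢y ∷ x≢z ∷ _) ∷ (y≢z ∷ _) ∷ _) (px ∷ py ∷ pz ∷ _) =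
  ⊥-elim (noThree x≢y x≢z y≢z px py pz)

mainTheorem7 : {c ℓ : Level} (F : CommutativeRing c ℓ) (q : ℕ) (α : CommutativeRing.Carrier F) (s u : ℕ) →
    OddPrimePower q →
    FieldDefs.IsField F →
    FieldDefs.IsPrimitiveOfOrder F (q ^ 4) α →
    FieldDefs.InD F q α s → ¬ (s ≡ FieldDefs.x₀ F q) →
    FieldDefs.InD F q α u → ¬ (u ≡ FieldDefs.x₀ F q) →
    CommutativeRing._≈_ F
      (CommutativeRing._*_ F (FieldDefs._^_ F (FieldDefs._^_ F α s) 2) (FieldDefs._^_ F (FieldDefs._^_ F α u) (q ^ 2)))
      (CommutativeRing._*_ F (FieldDefs._^_ F (FieldDefs._^_ F α s) (2 Data.Nat.* q ^ 2)) (FieldDefs._^_ F α u)) →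
    (is : List ℕ) → Unique is → All (FieldDefs.InOePΨ F q α s (FieldDefs._^_ F α u)) is →
    length is ≤ 2
mainTheorem7 F q α s u oddPrimePower isField prim (s<n , Tr[a]≈0) s≢x₀ _ _ H
  with OddNumbers.oddPrimePower⇒≡1+2t oddPrimePower
... | t , t≢0 , ≡.refl =
  noThreeDistinct⇒length≤2 (Intersection.noThreeDistinctPoints F isField t {{t≢0}} α prim s u H Tr[a]≈0 s<n s≢x₀)
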